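{- Let $t$ be a pure $\lambda$-term. If $t\to_\beta t'$ then $t\to_{\lambda j}^{+} t'$.
   Context: $\lambda j$-terms: $t,u ::= x \mid \lambda x.t \mid t\,u \mid t[x/u]$; $[x/u]$ is a jump, $\lambda x.t$ and $t[x/u]$ bind $x$ in $t$ (not in $u$), terms modulo $\alpha$-conversion; pure $\lambda$-terms are those without jumps, and $\to_\beta$ is the contextual closure of $(\lambda x.t)u\mapsto t\{x/u\}$. $|t|_x$ number of free occurrences of $x$, $t\{x/u\}$ capture-avoiding substitution. When $|t|_x\ge2$, $t_{[y]_x}$ is any term obtained by renaming $i$ free occurrences of $x$ into a fresh $y$, $1\le i\le|t|_x-1$. Rules: (dB) $(\lambda x.t)L\,u\mapsto t[x/u]L$, $L=[y_1/w_1]\dots[y_k/w_k]$ a possibly empty list of jumps with $\{y_1,\dots,y_k\}\cap\mathrm{fv}(u)=\emptyset$; (w) $t[x/u]\mapsto t$ if $|t|_x=0$; (d) $t[x/u]\mapsto t\{x/u\}$ if $|t|_x=1$; (c) $t[x/u]\mapsto t_{[y]_x}[x/u][y/u]$ if $|t|_x>1$, $y$ fresh. $\to_{\lambda j}$ is their contextual closure, $\to^+$ transitive closure. -}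

module Defs where

open import Data.Nat using (ℕ; zero; suc; _+_; _≤_; _<_)
open import Data.Fin using (Fin; zero; suc; _≟_)
open import Relation.Nullary using (yes; no)
open import Relation.Binary.PropositionalEquality using (_≡_)
open import Relation.Binary.Construct.Closure.Transitive using (TransClosure)

-- Term n : terms with at most n free variables (Fin n).
-- jmp t u  represents  t[x/u] , where x is bound as index zero in t
-- (and is NOT bound in u).
data Term (n : ℕ) : Set where
  var : Fin n → Term n
  lam : Term (suc n) → Term n
  app : Term n → Term n → Term n
  jmp : Term (suc n) → Term n → Term n

data Pure {n : ℕ} : Term n → Set where
  var : ∀ x → Pure (var x)
  lam : ∀ {t} → Pure t → Pure (lam t)
  app : ∀ {t u} → Pure t → Pure u → Pure (app t u)

ext : ∀ {n m} → (Fin n → Fin m) → Fin (suc n) → Fin (suc m)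
ext ρ zero    = zero
ext ρ (suc x) = suc (ρ x)

ren : ∀ {n m} → (Fin n → Fin m) → Term n → Term m
ren ρ (var x)   = var (ρ x)
ren ρ (lam t)   = lam (ren (ext ρ) t)
ren ρ (app t u) = app (ren ρ t) (ren ρ u)
ren ρ (jmp t u) = jmp (ren (ext ρ) t) (ren ρ u)

wk : ∀ {n} → Term n → Term (suc n)
wk = ren suc

exts : ∀ {n m} → (Fin n → Term m) → Fin (suc n) → Term (suc m)
exts σ zero    = var zero
exts σ (suc x) = wk (σ x)

sub : ∀ {n m} → (Fin n → Term m) → Term n → Term m
sub σ (var x)   = σ x
sub σ (lam t)   = lam (sub (exts σ) t)
sub σ (app t u) = app (sub σ t) (sub σ u)
sub σ (jmp t u) = jmp (sub (exts σ) t) (sub σ u)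

σ₀ : ∀ {n} → Term n → Fin (suc n) → Term n
σ₀ u zero    = u
σ₀ u (suc x) = var x

_[0:=_] : ∀ {n} → Term (suc n) → Term n → Term n
t [0:= u ] = sub (σ₀ u) t

occ : ∀ {n} → Term n → Fin n → ℕ
occ (var y)   x with x ≟ y
... | yes _ = 1
... | no  _ = 0
occ (lam t)   x = occ t (suc x)
occ (app t u) x = occ t x + occ u x
occ (jmp t u) x = occ t (suc x) + occ u x

-- Lists of jumps L = [y1/w1]...[yk/wk], as a context of jump binders.
-- JL n m : L put around a term of scope m yields a term of scope n.
data JL (n : ℕ) : ℕ → Set where
  []  : JL n n
  _∷_ : ∀ {m} → Term n → JL (suc n) m → JL n m

plug : ∀ {n m} → JL n m → Term m → Term n
plug []      t = t
plug (w ∷ L) t = jmp (plug L t) w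

-- weakening of a term of the outer scope under the binders of L
-- (the side condition {y1..yk} ∩ fv(u) = ∅, via α-conversion)
wkL : ∀ {n m} → JL n m → Term n → Term m
wkL []      u = u
wkL (w ∷ L) u = wkL L (wk u)

-- Contraction: t₂ : Term (2+n) is t_{[y]_x} where index 0 = x, index 1 = y
-- (y fresh); merging y back into x gives t.
merge : ∀ {n} → Fin (suc (suc n)) → Fin (suc n)
merge zero          = zero
merge (suc zero)    = zero
merge (suc (suc k)) = suc k

data _↦λj_ {n : ℕ} : Term n → Term n → Set where
  dB : ∀ {m} (L : JL n m) (t : Term (suc m)) (u : Term n) →
       app (plug L (lam t)) u ↦λj plug L (jmp t (wkL L u))
  w  : ∀ (t : Term (suc n)) (u : Term n) → occ t zero ≡ 0 →
       jmp t u ↦λj (t [0:= u ])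
  d  : ∀ (t : Term (suc n)) (u : Term n) → occ t zero ≡ 1 →
       jmp t u ↦λj (t [0:= u ])
  c  : ∀ (t : Term (suc n)) (t₂ : Term (suc (suc n))) (u : Term n) →
       1 < occ t zero →
       ren merge t₂ ≡ t →               -- t₂ is t with some x's renamed to y
       1 ≤ occ t₂ (suc zero) →          -- i ≥ 1 occurrences renamed
       1 ≤ occ t₂ zero →                -- i ≤ |t|_x - 1
       jmp t u ↦λj jmp (jmp t₂ (wk u)) u   -- t_{[y]_x}[x/u][y/u]

data _→λj_ : ∀ {n} → Term n → Term n → Set where
  root : ∀ {n} {t t' : Term n} → t ↦λj t' → t →λj t'
  lamC : ∀ {n} {t t' : Term (suc n)} → t →λj t' → lam t →λj lam t'
  appL : ∀ {n} {t t' u : Term n} → t →λj t' → app t u →λj app t' u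
  appR : ∀ {n} {t u u' : Term n} → u →λj u' → app t u →λj app t u'
  jmpL : ∀ {n} {t t' : Term (suc n)} {u : Term n} → t →λj t' → jmp t u →λj jmp t' u
  jmpR : ∀ {n} {t : Term (suc n)} {u u' : Term n} → u →λj u' → jmp t u →λj jmp t u'

_→λj⁺_ : ∀ {n} → Term n → Term n → Set
_→λj⁺_ = TransClosure _→λj_

data _→β_ : ∀ {n} → Term n → Term n → Set where
  β    : ∀ {n} (t : Term (suc n)) (u : Term n) → app (lam t) u →β (t [0:= u ])
  lamC : ∀ {n} {t t' : Term (suc n)} → t →β t' → lam t →β lam t'
  appL : ∀ {n} {t t' u : Term n} → t →β t' → app t u →β app t' u
  appR : ∀ {n} {t u u' : Term n} → u →β u' → app t u →β app t u'

-- A β-step (λx.t)u → t{x/u} is simulated by dB, giving t[x/u], followed by the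
-- elimination of that jump.  If x does not occur in t, rule w removes it.  Otherwise
-- we induct on |t|_x: with one occurrence, rule d substitutes it; with more, rule c
-- splits off the leftmost occurrence into a fresh y, the inner jump on x is eliminated
-- by induction, and the remaining jump on y, whose variable occurs once, by d.
module Submission where

open import Defs
open import Data.Nat using (zero; suc; _+_; _≤_; _<_; s≤s; z≤n)
open import Data.Nat.Properties using (suc-injective; ≤-reflexive)
open import Data.Fin using (Fin; zero; suc; _≟_)
import Data.Fin.Properties as Finₚ
open import Data.Empty using (⊥-elim)
open import Function using (_∘_; id)
open import Function.Definitions using (Injective)
open import Relation.Nullary using (yes; no)
open import Relation.Binary.PropositionalEquality
open import Relation.Binary.Construct.Closure.Transitive using (TransClosure; [_]; _∷_; _∷ʳ_)

map⁺ : ∀ {a b r s} {A : Set a} {B : Set b} {R : A → A → Set r} {S : B → B → Set s}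
       (f : A → B) → (∀ {x y} → R x y → S (f x) (f y)) →
       ∀ {x y} → TransClosure R x y → TransClosure S (f x) (f y)
map⁺ f g [ r ]     = [ g r ]
map⁺ f g (r ∷ rs) = g r ∷ map⁺ f g rs

ext-cong : ∀ {n m} {ρ ρ' : Fin n → Fin m} → ρ ≗ ρ' → ext ρ ≗ ext ρ'
ext-cong e zero    = refl
ext-cong e (suc x) = cong suc (e x)

ext-id : ∀ {n} {ρ : Fin n → Fin n} → ρ ≗ id → ext ρ ≗ id
ext-id e zero    = refl
ext-id e (suc x) = cong suc (e x)

ext-∘ : ∀ {n m k} (f : Fin m → Fin k) (g : Fin n → Fin m) → ext f ∘ ext g ≗ ext (f ∘ g)
ext-∘ f g zero    = refl
ext-∘ f g (suc x) = refl

ext-inverse : ∀ {n m} {f : Fin m → Fin n} {ρ : Fin n → Fin m} → f ∘ ρ ≗ id → ext f ∘ ext ρ ≗ id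
ext-inverse e zero    = refl
ext-inverse e (suc x) = cong suc (e x)

ren-cong : ∀ {n m} {ρ ρ' : Fin n → Fin m} → ρ ≗ ρ' → ren ρ ≗ ren ρ'
ren-cong e (var x)   = cong var (e x)
ren-cong e (lam t)   = cong lam (ren-cong (ext-cong e) t)
ren-cong e (app t u) = cong₂ app (ren-cong e t) (ren-cong e u)
ren-cong e (jmp t u) = cong₂ jmp (ren-cong (ext-cong e) t) (ren-cong e u)

ren-id : ∀ {n} {ρ : Fin n → Fin n} → ρ ≗ id → ren ρ ≗ id
ren-id e (var x)   = cong var (e x)
ren-id e (lam t)   = cong lam (ren-id (ext-id e) t)
ren-id e (app t u) = cong₂ app (ren-id e t) (ren-id e u)
ren-id e (jmp t u) = cong₂ jmp (ren-id (ext-id e) t) (ren-id e u)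

ren-∘ : ∀ {n m k} (f : Fin m → Fin k) (g : Fin n → Fin m) → ren f ∘ ren g ≗ ren (f ∘ g)
ren-∘ f g (var x)   = refl
ren-∘ f g (lam t)   = cong lam (trans (ren-∘ (ext f) (ext g) t) (ren-cong (ext-∘ f g) t))
ren-∘ f g (app t u) = cong₂ app (ren-∘ f g t) (ren-∘ f g u)
ren-∘ f g (jmp t u) = cong₂ jmp (trans (ren-∘ (ext f) (ext g) t) (ren-cong (ext-∘ f g) t))
                                (ren-∘ f g u)

exts-cong : ∀ {n m} {σ σ' : Fin n → Term m} → σ ≗ σ' → exts σ ≗ exts σ'
exts-cong e zero    = refl
exts-cong e (suc x) = cong wk (e x)

exts-ext : ∀ {n m k} (σ : Fin m → Term k) (ρ : Fin n → Fin m) →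
           exts σ ∘ ext ρ ≗ exts (σ ∘ ρ)
exts-ext σ ρ zero    = refl
exts-ext σ ρ (suc x) = refl

ren-exts : ∀ {n m k} (ρ : Fin m → Fin k) (σ : Fin n → Term m) →
           ren (ext ρ) ∘ exts σ ≗ exts (ren ρ ∘ σ)
ren-exts ρ σ zero    = refl
ren-exts ρ σ (suc x) = trans (ren-∘ (ext ρ) suc (σ x)) (sym (ren-∘ suc ρ (σ x)))

sub-cong : ∀ {n m} {σ σ' : Fin n → Term m} → σ ≗ σ' → sub σ ≗ sub σ'
sub-cong e (var x)   = e x
sub-cong e (lam t)   = cong lam (sub-cong (exts-cong e) t)
sub-cong e (app t u) = cong₂ app (sub-cong e t) (sub-cong e u)
sub-cong e (jmp t u) = cong₂ jmp (sub-cong (exts-cong e) t) (sub-cong e u)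

exts-var : ∀ {n} {σ : Fin n → Term n} → σ ≗ var → exts σ ≗ var
exts-var e zero    = refl
exts-var e (suc x) = cong wk (e x)

sub-var : ∀ {n} {σ : Fin n → Term n} → σ ≗ var → sub σ ≗ id
sub-var e (var x)   = e x
sub-var e (lam t)   = cong lam (sub-var (exts-var e) t)
sub-var e (app t u) = cong₂ app (sub-var e t) (sub-var e u)
sub-var e (jmp t u) = cong₂ jmp (sub-var (exts-var e) t) (sub-var e u)

sub-ren : ∀ {n m k} (σ : Fin m → Term k) (ρ : Fin n → Fin m) → sub σ ∘ ren ρ ≗ sub (σ ∘ ρ)
sub-ren σ ρ (var x)   = refl
sub-ren σ ρ (lam t)   = cong lam (trans (sub-ren (exts σ) (ext ρ) t) (sub-cong (exts-ext σ ρ) t))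
sub-ren σ ρ (app t u) = cong₂ app (sub-ren σ ρ t) (sub-ren σ ρ u)
sub-ren σ ρ (jmp t u) = cong₂ jmp (trans (sub-ren (exts σ) (ext ρ) t) (sub-cong (exts-ext σ ρ) t))
                                  (sub-ren σ ρ u)

ren-sub : ∀ {n m k} (ρ : Fin m → Fin k) (σ : Fin n → Term m) → ren ρ ∘ sub σ ≗ sub (ren ρ ∘ σ)
ren-sub ρ σ (var x)   = refl
ren-sub ρ σ (lam t)   = cong lam (trans (ren-sub (ext ρ) (exts σ) t) (sub-cong (ren-exts ρ σ) t))
ren-sub ρ σ (app t u) = cong₂ app (ren-sub ρ σ t) (ren-sub ρ σ u)
ren-sub ρ σ (jmp t u) = cong₂ jmp (trans (ren-sub (ext ρ) (exts σ) t) (sub-cong (ren-exts ρ σ) t))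
                                  (ren-sub ρ σ u)

sub-exts : ∀ {n m k} (σ : Fin m → Term k) (τ : Fin n → Term m) →
           sub (exts σ) ∘ exts τ ≗ exts (sub σ ∘ τ)
sub-exts σ τ zero    = refl
sub-exts σ τ (suc x) = trans (sub-ren (exts σ) suc (τ x)) (sym (ren-sub suc σ (τ x)))

sub-∘ : ∀ {n m k} (σ : Fin m → Term k) (τ : Fin n → Term m) → sub σ ∘ sub τ ≗ sub (sub σ ∘ τ)
sub-∘ σ τ (var x)   = refl
sub-∘ σ τ (lam t)   = cong lam (trans (sub-∘ (exts σ) (exts τ) t) (sub-cong (sub-exts σ τ) t))
sub-∘ σ τ (app t u) = cong₂ app (sub-∘ σ τ t) (sub-∘ σ τ u)
sub-∘ σ τ (jmp t u) = cong₂ jmp (trans (sub-∘ (exts σ) (exts τ) t) (sub-cong (sub-exts σ τ) t))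
                                (sub-∘ σ τ u)

[0:=]-wk : ∀ {n} (t u : Term n) → wk t [0:= u ] ≡ t
[0:=]-wk t u = trans (sub-ren (σ₀ u) suc t) (sub-var (λ _ → refl) t)

[0:=wk][0:=]-merge : ∀ {n} (t : Term (suc (suc n))) (u : Term n) →
                     (t [0:= wk u ]) [0:= u ] ≡ ren merge t [0:= u ]
[0:=wk][0:=]-merge t u = begin
  (t [0:= wk u ]) [0:= u ]                  ≡⟨ sub-∘ (σ₀ u) (σ₀ (wk u)) t ⟩
  sub (sub (σ₀ u) ∘ σ₀ (wk u)) t            ≡⟨ sub-cong agree t ⟩
  sub (σ₀ u ∘ merge) t                      ≡⟨ sub-ren (σ₀ u) merge t ⟨
  ren merge t [0:= u ]                      ∎
  where
  open ≡-Reasoning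
  agree : sub (σ₀ u) ∘ σ₀ (wk u) ≗ σ₀ u ∘ merge
  agree zero          = [0:=]-wk u u
  agree (suc zero)    = refl
  agree (suc (suc x)) = refl

occ-var-self : ∀ {n} (x : Fin n) → occ (var x) x ≡ 1
occ-var-self x with x ≟ x
... | yes _  = refl
... | no x≢x = ⊥-elim (x≢x refl)

occ-var-≢ : ∀ {n} {x y : Fin n} → x ≢ y → occ (var y) x ≡ 0
occ-var-≢ {x = x} {y} x≢y with x ≟ y
... | yes x≡y = ⊥-elim (x≢y x≡y)
... | no _    = refl

occ-var-suc : ∀ {n} (x y : Fin n) → occ (var (suc y)) (suc x) ≡ occ (var y) x
occ-var-suc x y with x ≟ y
... | yes _ = refl
... | no _  = refl

ext-injective : ∀ {n m} {ρ : Fin n → Fin m} → Injective _≡_ _≡_ ρ → Injective _≡_ _≡_ (ext ρ)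
ext-injective inj {zero}  {zero}  _  = refl
ext-injective inj {suc x} {suc y} eq = cong suc (inj (Finₚ.suc-injective eq))

occ-ren-injective : ∀ {n m} {ρ : Fin n → Fin m} → Injective _≡_ _≡_ ρ →
                    ∀ t x → occ (ren ρ t) (ρ x) ≡ occ t x
occ-ren-injective {ρ = ρ} inj (var y) x with ρ x ≟ ρ y | x ≟ y
... | yes _    | yes _    = refl
... | no _     | no _     = refl
... | yes ρx≡ρy | no x≢y  = ⊥-elim (x≢y (inj ρx≡ρy))
... | no ρx≢ρy | yes x≡y  = ⊥-elim (ρx≢ρy (cong ρ x≡y))
occ-ren-injective inj (lam t)   x = occ-ren-injective (ext-injective inj) t (suc x)
occ-ren-injective inj (app t u) x = cong₂ _+_ (occ-ren-injective inj t x) (occ-ren-injective inj u x)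
occ-ren-injective inj (jmp t u) x = cong₂ _+_ (occ-ren-injective (ext-injective inj) t (suc x))
                                               (occ-ren-injective inj u x)

ext-∉ : ∀ {n m} {ρ : Fin n → Fin m} {y} → (∀ x → ρ x ≢ y) → ∀ x → ext ρ x ≢ suc y
ext-∉ ρ∌y (suc x) eq = ρ∌y x (Finₚ.suc-injective eq)

occ-ren-∉ : ∀ {n m} {ρ : Fin n → Fin m} {y} → (∀ x → ρ x ≢ y) → ∀ t → occ (ren ρ t) y ≡ 0
occ-ren-∉ ρ∌y (var x)   = occ-var-≢ (ρ∌y x ∘ sym)
occ-ren-∉ ρ∌y (lam t)   = occ-ren-∉ (ext-∉ ρ∌y) t
occ-ren-∉ ρ∌y (app t u) = cong₂ _+_ (occ-ren-∉ ρ∌y t) (occ-ren-∉ ρ∌y u)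
occ-ren-∉ ρ∌y (jmp t u) = cong₂ _+_ (occ-ren-∉ (ext-∉ ρ∌y) t) (occ-ren-∉ ρ∌y u)

occ-exts : ∀ {n m} (σ : Fin n → Term m) (x : Fin n) (z : Fin m) →
           (∀ y → occ (σ y) z ≡ occ (var y) x) →
           ∀ y → occ (exts σ y) (suc z) ≡ occ (var y) (suc x)
occ-exts σ x z hσ zero    = refl
occ-exts σ x z hσ (suc y) =
  trans (occ-ren-injective Finₚ.suc-injective (σ y) z) (trans (hσ y) (sym (occ-var-suc x y)))

occ-sub : ∀ {n m} (σ : Fin n → Term m) (x : Fin n) (z : Fin m) →
          (∀ y → occ (σ y) z ≡ occ (var y) x) → ∀ t → occ (sub σ t) z ≡ occ t x
occ-sub σ x z hσ (var y)   = hσ y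
occ-sub σ x z hσ (lam t)   = occ-sub (exts σ) (suc x) (suc z) (occ-exts σ x z hσ) t
occ-sub σ x z hσ (app t u) = cong₂ _+_ (occ-sub σ x z hσ t) (occ-sub σ x z hσ u)
occ-sub σ x z hσ (jmp t u) = cong₂ _+_ (occ-sub (exts σ) (suc x) (suc z) (occ-exts σ x z hσ) t)
                                        (occ-sub σ x z hσ u)

occ-[0:=wk] : ∀ {n} (t : Term (suc (suc n))) (u : Term n) →
              occ (t [0:= wk u ]) zero ≡ occ t (suc zero)
occ-[0:=wk] {n} t u = occ-sub (σ₀ (wk u)) (suc zero) zero hσ t
  where
  hσ : ∀ y → occ (σ₀ (wk u) y) zero ≡ occ (var y) (suc zero)
  hσ zero          = occ-ren-∉ (λ _ ()) u
  hσ (suc zero)    = refl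
  hσ (suc (suc y)) = refl

splitFirst : ∀ {n m} → Term n → Fin n → (Fin n → Fin m) → Fin m → Term m
splitFirst (var z) x ρ y with x ≟ z
... | yes _ = var y
... | no _  = var (ρ z)
splitFirst (lam t) x ρ y = lam (splitFirst t (suc x) (ext ρ) (suc y))
splitFirst (app t u) x ρ y with occ t x
... | zero  = app (ren ρ t) (splitFirst u x ρ y)
... | suc _ = app (splitFirst t x ρ y) (ren ρ u)
splitFirst (jmp t u) x ρ y with occ t (suc x)
... | zero  = jmp (ren (ext ρ) t) (splitFirst u x ρ y)
... | suc _ = jmp (splitFirst t (suc x) (ext ρ) (suc y)) (ren ρ u)

ren-splitFirst : ∀ {n m} {f : Fin m → Fin n} {ρ : Fin n → Fin m} {x y} →
                 f ∘ ρ ≗ id → f y ≡ x → ∀ t → ren f (splitFirst t x ρ y) ≡ t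
ren-splitFirst {f = f} {ρ} {x} e fy≡x (var z) with x ≟ z
... | yes refl = cong var fy≡x
... | no _     = cong var (e z)
ren-splitFirst e fy≡x (lam t) =
  cong lam (ren-splitFirst (ext-inverse e) (cong suc fy≡x) t)
ren-splitFirst {f = f} {ρ} {x} e fy≡x (app t u) with occ t x
... | zero  = cong₂ app (trans (ren-∘ f ρ t) (ren-id e t)) (ren-splitFirst e fy≡x u)
... | suc _ = cong₂ app (ren-splitFirst e fy≡x t) (trans (ren-∘ f ρ u) (ren-id e u))
ren-splitFirst {f = f} {ρ} {x} e fy≡x (jmp t u) with occ t (suc x)
... | zero  = cong₂ jmp (trans (ren-∘ (ext f) (ext ρ) t) (ren-id (ext-inverse e) t))
                        (ren-splitFirst e fy≡x u)
... | suc _ = cong₂ jmp (ren-splitFirst (ext-inverse e) (cong suc fy≡x) t)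
                        (trans (ren-∘ f ρ u) (ren-id e u))

occ-splitFirst-x : ∀ {n m} {ρ : Fin n → Fin m} {y} → Injective _≡_ _≡_ ρ → (∀ x → ρ x ≢ y) →
                   ∀ t x {k} → occ t x ≡ suc k → occ (splitFirst t x ρ y) (ρ x) ≡ k
occ-splitFirst-x {ρ = ρ} inj ρ∌y (var z) x eq with x ≟ z
... | yes _ = trans (occ-var-≢ (ρ∌y x)) (suc-injective eq)
occ-splitFirst-x inj ρ∌y (lam t) x eq =
  occ-splitFirst-x (ext-injective inj) (ext-∉ ρ∌y) t (suc x) eq
occ-splitFirst-x inj ρ∌y (app t u) x eq with occ t x in e
... | zero  = cong₂ _+_ (trans (occ-ren-injective inj t x) e) (occ-splitFirst-x inj ρ∌y u x eq)
... | suc _ = trans (cong₂ _+_ (occ-splitFirst-x inj ρ∌y t x e) (occ-ren-injective inj u x))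
                    (suc-injective eq)
occ-splitFirst-x inj ρ∌y (jmp t u) x eq with occ t (suc x) in e
... | zero  = cong₂ _+_ (trans (occ-ren-injective (ext-injective inj) t (suc x)) e)
                        (occ-splitFirst-x inj ρ∌y u x eq)
... | suc _ = trans (cong₂ _+_ (occ-splitFirst-x (ext-injective inj) (ext-∉ ρ∌y) t (suc x) e)
                               (occ-ren-injective inj u x))
                    (suc-injective eq)

occ-splitFirst-y : ∀ {n m} {ρ : Fin n → Fin m} {y} → Injective _≡_ _≡_ ρ → (∀ x → ρ x ≢ y) →
                   ∀ t x {k} → occ t x ≡ suc k → occ (splitFirst t x ρ y) y ≡ 1
occ-splitFirst-y {y = y} inj ρ∌y (var z) x eq with x ≟ z
... | yes _ = occ-var-self y
occ-splitFirst-y inj ρ∌y (lam t) x eq =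
  occ-splitFirst-y (ext-injective inj) (ext-∉ ρ∌y) t (suc x) eq
occ-splitFirst-y inj ρ∌y (app t u) x eq with occ t x in e
... | zero  = cong₂ _+_ (occ-ren-∉ ρ∌y t) (occ-splitFirst-y inj ρ∌y u x eq)
... | suc _ = cong₂ _+_ (occ-splitFirst-y inj ρ∌y t x e) (occ-ren-∉ ρ∌y u)
occ-splitFirst-y inj ρ∌y (jmp t u) x eq with occ t (suc x) in e
... | zero  = cong₂ _+_ (occ-ren-∉ (ext-∉ ρ∌y) t) (occ-splitFirst-y inj ρ∌y u x eq)
... | suc _ = cong₂ _+_ (occ-splitFirst-y (ext-injective inj) (ext-∉ ρ∌y) t (suc x) e)
                        (occ-ren-∉ ρ∌y u)

jmp-→λj⁺-[0:=]-occ : ∀ {n} k (t : Term (suc n)) (u : Term n) →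
                     occ t zero ≡ suc k → jmp t u →λj⁺ (t [0:= u ])
jmp-→λj⁺-[0:=]-occ zero    t u once = [ root (d t u once) ]
jmp-→λj⁺-[0:=]-occ {n} (suc k) t u occ≡ =
  root (c t t₂ u (subst (1 <_) (sym occ≡) (s≤s (s≤s z≤n))) merge-t₂
          (≤-reflexive (sym y-once)) (subst (1 ≤_) (sym x-occ) (s≤s z≤n)))
  ∷ map⁺ (λ a → jmp a u) jmpL (jmp-→λj⁺-[0:=]-occ k t₂ (wk u) x-occ)
  ∷ʳ subst (jmp (t₂ [0:= wk u ]) u →λj_) same-result
       (root (d (t₂ [0:= wk u ]) u (trans (occ-[0:=wk] t₂ u) y-once)))
  where
  -- t_{[y]_x} renaming only the leftmost x; x stays index 0 and the fresh y is index 1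
  t₂ : Term (suc (suc n))
  t₂ = splitFirst t zero (ext suc) (suc zero)
  ext-suc-injective : Injective _≡_ _≡_ (ext {n} suc)
  ext-suc-injective = ext-injective Finₚ.suc-injective
  ext-suc-∌1 : ∀ x → ext {n} suc x ≢ suc zero
  ext-suc-∌1 = ext-∉ λ _ ()
  merge-t₂ : ren merge t₂ ≡ t
  merge-t₂ = ren-splitFirst (λ { zero → refl ; (suc _) → refl }) refl t
  x-occ : occ t₂ zero ≡ suc k
  x-occ = occ-splitFirst-x ext-suc-injective ext-suc-∌1 t zero occ≡
  y-once : occ t₂ (suc zero) ≡ 1
  y-once = occ-splitFirst-y ext-suc-injective ext-suc-∌1 t zero occ≡
  same-result : (t₂ [0:= wk u ]) [0:= u ] ≡ t [0:= u ]
  same-result = trans ([0:=wk][0:=]-merge t₂ u) (cong (_[0:= u ]) merge-t₂)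

jmp-→λj⁺-[0:=] : ∀ {n} (t : Term (suc n)) (u : Term n) → jmp t u →λj⁺ (t [0:= u ])
jmp-→λj⁺-[0:=] t u with occ t zero in occ≡
... | zero  = [ root (w t u occ≡) ]
... | suc k = jmp-→λj⁺-[0:=]-occ k t u occ≡

→β⇒→λj⁺ : ∀ {n} {t t' : Term n} → t →β t' → t →λj⁺ t'
→β⇒→λj⁺ (β t u)          = root (dB [] t u) ∷ jmp-→λj⁺-[0:=] t u
→β⇒→λj⁺ (lamC r)         = map⁺ lam lamC (→β⇒→λj⁺ r)
→β⇒→λj⁺ (appL {u = u} r) = map⁺ (λ a → app a u) appL (→β⇒→λj⁺ r)
→β⇒→λj⁺ (appR {t = t} r) = map⁺ (app t) appR (→β⇒→λj⁺ r)

lemma2p4 : ∀ {n} (t t' : Term n) → Pure t → t →β t' → t →λj⁺ t'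
lemma2p4 t t' _ = →β⇒→λj⁺
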